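{- Let $H$ be an unweighted $k$-colorable strongly canonical clump graph with layers $L_0,\ldots,L_D$. Then the sequence of layers $L_0,\ldots,L_D$ can be partitioned into contiguous segments each of which is of Type 1, Type 2 or Type 3. Moreover, if $k\in\{3,4\}$ and $L_j$ is a layer in a Type 1 or Type 2 segment, then $L_j=S_j$ and $|L_j|\in\{1,k-1\}$.
   Context: $N(x)$ is the neighborhood of $x$ in $H$. Fix $k\ge 3$. A graph $G$ is $k$-colored if a fixed proper coloring with colors from $\{1,\ldots,k\}$ is given. A connected graph $G$ is layered if a vertex $x$ of eccentricity $D=\operatorname{diam}(G)$ is fixed, together with layers $L_0=\{x\},\ldots,L_D$, $L_i$ being the vertices at distance $i$ from $x$; $c(i)$ is the number of colors used on $L_i$. $G$ is saturated if any two differently colored vertices in the same layer or in consecutive layers are adjacent. Such $G$ is canonical if for every $0\le i\le D-1$: (a) $c(i)=1$ implies $c(i+1)\le k-1$; (b) $L_i\cup L_{i+1}$ uses $\min(k,c(i)+c(i+1))$ colors; (c) $c(i)=k$ implies $i\ge 2$ and $c(i+1)\ge 2$; (d) if $L_i$ contains two vertices of the same color then $i>0$ and $c(i)+\max(c(i-1),c(i+1))\ge k$. A clump is a nonempty set of all vertices of a layer $L_i$ of a given color. The clump graph $H=H(G)$ has the clumps as vertices, adjacent iff some edge of $G$ joins them, inheriting colors and layers (layer $L_i$ of $H$ is the set of clumps in $L_i$, so $|L_i|=c(i)$). An unweighted $k$-colorable strongly canonical clump graph is $H=H(G)$ with $D\ge 2$ and $G$ saturated, $k$-colored, layered, connected,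 canonical, with $c(0)=c(D)=1$. Set $L_{ -1}=L_{D+1}=\emptyset$; for $0\le i\le D$, $S_i=\{x\in L_i: L_{i-1}\cup L_{i+1}\subseteq N(x)\}$, and $S_{ -1}=S_{D+1}=\emptyset$. Layer $L_i$ is big if $|S_i|>k/2$, small otherwise. A contiguous segment $L_i,L_{i+1},\ldots,L_{i+2s}$ with $s\ge 1$ is of Type 1 if $s=1$ and of Type 2 if $s>1$, provided: for each $1\le j\le s$ the layer $L_{i+2j-1}$ is big (and then $L_{i+2j-2},L_{i+2j}$ are small); $i=0$ or $L_{i-1}$ is small; and $i+2s=D$ or $L_{i+2s+1}$ is small. A contiguous segment $L_i,\ldots,L_{i+t}$ with $t\ge 0$ is of Type 3 if: every layer $L_j$, $i\le j\le i+t$, is small; if $i\ne 0$ then $i>2$ and $L_{i-2}$ is big; and if $i+t\ne D$ then $i+t<D-2$ and $L_{i+t+2}$ is big. -}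

module Defs where

open import Data.Nat using (ℕ; zero; suc; _+_; _*_; _∸_; _≤_; _<_; _⊔_; _⊓_; pred)
import Data.Nat.Properties as ℕP
open import Data.Fin using (Fin)
import Data.Fin.Properties as FinP
open import Data.Bool using (Bool; true)
open import Data.Bool.Properties using () renaming (_≟_ to _≟ᵇ_)
open import Data.List using (List; length; filter)
open import Data.Fin.Base using () renaming (zero to fzero)
open import Data.List using () renaming (allFin to allFinL)
open import Data.Product using (Σ; ∃; ∃-syntax; _×_; _,_)
open import Data.Product.Properties using ()
open import Data.Sum using (_⊎_)
open import Data.Unit using (⊤; tt)
open import Relation.Nullary using (¬_; Dec; yes; no)
open import Relation.Nullary.Decidable using (_×-dec_; _⊎-dec_; _→-dec_)
open import Relation.Binary.PropositionalEquality using (_≡_; _≢_)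

module Graph {n : ℕ} (adj : Fin n → Fin n → Bool) where

  Edge : Fin n → Fin n → Set
  Edge u v = adj u v ≡ true

  edge? : (u v : Fin n) → Dec (Edge u v)
  edge? u v = adj u v ≟ᵇ true

  data Walk : Fin n → Fin n → ℕ → Set where
    here : ∀ {u} → Walk u u 0
    step : ∀ {u v w m} → Edge u v → Walk v w m → Walk u w (suc m)

  Dist : Fin n → Fin n → ℕ → Set
  Dist u v d = Walk u v d × (∀ m → Walk u v m → d ≤ m)

  Symmetric : Set
  Symmetric = ∀ u v → Edge u v → Edge v u

  Irreflexive : Set
  Irreflexive = ∀ u → ¬ Edge u u

  Connected : Set
  Connected = ∀ u v → ∃[ m ] Walk u v m

count : ∀ {k} {P : Fin k → Set} → ((a : Fin k) → Dec (P a)) → ℕ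
count {k} P? = length (filter P? (allFinL k))

-- Notions attached to a k-colored layered graph.
--   col : Fin n → Fin k   (colors are Fin k, i.e. {1,…,k} shifted)
--   lay : Fin n → ℕ       (lay v = the index i with v ∈ L_i)

module Layered {n k : ℕ} (adj : Fin n → Fin n → Bool)
               (col : Fin n → Fin k) (lay : Fin n → ℕ) where

  open Graph adj

  -- the clump (L_i, color a) is nonempty, i.e. color a is used on L_i
  IsClump : ℕ → Fin k → Set
  IsClump i a = ∃[ v ] (lay v ≡ i × col v ≡ a)

  isClump? : ∀ i a → Dec (IsClump i a)
  isClump? i a = FinP.any? (λ v → (lay v ℕP.≟ i) ×-dec (col v FinP.≟ a))

  -- c(i): number of colors used on L_i  (= |L_i| in the clump graph H)
  c : ℕ → ℕ
  c i = count (isClump? i)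

  cUnion : ℕ → ℕ
  cUnion i = count (λ a → isClump? i a ⊎-dec isClump? (suc i) a)

  ClumpAdj : ℕ → Fin k → ℕ → Fin k → Set
  ClumpAdj i a j b = ∃[ u ] ∃[ v ]
    (Edge u v × lay u ≡ i × col u ≡ a × lay v ≡ j × col v ≡ b)

  clumpAdj? : ∀ i a j b → Dec (ClumpAdj i a j b)
  clumpAdj? i a j b = FinP.any? (λ u → FinP.any? (λ v →
    edge? u v ×-dec ((lay u ℕP.≟ i) ×-dec ((col u FinP.≟ a) ×-dec
      ((lay v ℕP.≟ j) ×-dec (col v FinP.≟ b))))))

  -- every clump of layer L_{i-1} is adjacent to (i,a); vacuous for i = 0
  -- (L_{-1} = ∅)
  PrevOK : ℕ → Fin k → Set
  PrevOK zero    a = ⊤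
  PrevOK (suc i) a = ∀ b → IsClump i b → ClumpAdj (suc i) a i b

  prevOK? : ∀ i a → Dec (PrevOK i a)
  prevOK? zero    a = yes tt
  prevOK? (suc i) a =
    FinP.all? (λ b → isClump? i b →-dec clumpAdj? (suc i) a i b)

  NextOK : ℕ → Fin k → Set
  NextOK i a = ∀ b → IsClump (suc i) b → ClumpAdj i a (suc i) b

  nextOK? : ∀ i a → Dec (NextOK i a)
  nextOK? i a =
    FinP.all? (λ b → isClump? (suc i) b →-dec clumpAdj? i a (suc i) b)

  InS : ℕ → Fin k → Set
  InS i a = IsClump i a × PrevOK i a × NextOK i a

  inS? : ∀ i a → Dec (InS i a)
  inS? i a = isClump? i a ×-dec (prevOK? i a ×-dec nextOK? i a)

  sizeS : ℕ → ℕ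
  sizeS i = count (inS? i)

  Big : ℕ → Set
  Big i = k < 2 * sizeS i

  Small : ℕ → Set
  Small i = ¬ Big i

  module Segments (D : ℕ) where

    -- L_i,…,L_{i+2s} satisfies the common Type 1/2 conditions
    Alt : ℕ → ℕ → Set
    Alt i s =
      1 ≤ s × i + 2 * s ≤ D ×
      (∀ j → 1 ≤ j → j ≤ s →
         Big (i + 2 * j ∸ 1) × Small (i + 2 * (j ∸ 1)) × Small (i + 2 * j)) ×
      (i ≡ 0 ⊎ Small (i ∸ 1)) ×
      (i + 2 * s ≡ D ⊎ Small (suc (i + 2 * s)))

    Type1 : ℕ → ℕ → Set
    Type1 a b = b ≡ a + 2 * 1 × Alt a 1

    Type2 : ℕ → ℕ → Set
    Type2 a b = ∃[ s ] (1 < s × b ≡ a + 2 * s × Alt a s)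

    Type3 : ℕ → ℕ → Set
    Type3 a b =
      a ≤ b × b ≤ D ×
      (∀ j → a ≤ j → j ≤ b → Small j) ×
      (a ≢ 0 → 2 < a × Big (a ∸ 2)) ×
      (b ≢ D → b < D ∸ 2 × Big (b + 2))

    SegType : ℕ → ℕ → Set
    SegType a b = Type1 a b ⊎ Type2 a b ⊎ Type3 a b

  data Partition (P : ℕ → ℕ → Set) : ℕ → ℕ → Set where
    one  : ∀ {a b} → P a b → Partition P a b
    cons : ∀ {a m b} → P a m → Partition P (suc m) b → Partition P a b

-- The hypothesis: H = H(G) is an unweighted k-colorable strongly
-- canonical clump graph, where G is given by
--   n, adj (simple graph on Fin n), col (k-coloring), x, lay (layering), D.

record StronglyCanonical (k n : ℕ) (adj : Fin n → Fin n → Bool)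
       (col : Fin n → Fin k) (x : Fin n) (lay : Fin n → ℕ) (D : ℕ) : Set where
  open Graph adj
  open Layered adj col lay
  field
    symmetric   : Symmetric
    irreflexive : Irreflexive
    connected   : Connected
    proper      : ∀ u v → Edge u v → col u ≢ col v
    layDist     : ∀ v → Dist x v (lay v)
    eccAttained : ∃[ v ] lay v ≡ D
    diamBound   : ∀ u v d → Dist u v d → d ≤ D
    saturated   : ∀ u v → col u ≢ col v →
                  (lay u ≡ lay v ⊎ suc (lay u) ≡ lay v ⊎ lay u ≡ suc (lay v)) →
                  Edge u v
    canonA : ∀ i → i < D → c i ≡ 1 → c (suc i) ≤ k ∸ 1
    canonB : ∀ i → i < D → cUnion i ≡ k ⊓ (c i + c (suc i))
    canonC : ∀ i → i < D → c i ≡ k → 2 ≤ i × 2 ≤ c (suc i)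
    canonD : ∀ i → i < D →
             (∃[ u ] ∃[ v ] (u ≢ v × lay u ≡ i × lay v ≡ i × col u ≡ col v)) →
             0 < i × k ≤ c i + (c (pred i) ⊔ c (suc i))
    D≥2 : 2 ≤ D
    c0  : c 0 ≡ 1
    cD  : c D ≡ 1

-- A clump of S_j is adjacent to every clump of L_{j-1} and L_{j+1}, so its colour is
-- missing from both neighbouring layers: c(j ± 1) + |S_j| ≤ k.  Two consecutive big layers
-- would therefore have |S_j| + |S_{j+1}| ≤ k, so big layers are isolated, and L_0, L_D
-- (one colour each) are small.  Scanning from L_0, a maximal stretch "small, big, small, …,
-- big, small" with the big layers two apart is a Type 1/2 segment, and a maximal stretch of
-- small layers between two of them is a Type 3 segment.
-- For k ∈ {3, 4}, |S_j| > k/2 forces |S_j| ≥ k - 1, so a big layer has c(j) = |S_j| = k - 1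
-- and its neighbours have a single colour; a one-coloured layer shares no colour with its
-- neighbours (by canonicity), hence by saturation its clump lies in S.

module Submission where

open import Data.Bool using (Bool)
open import Data.Empty using (⊥-elim)
open import Data.Fin using (Fin)
open import Data.List using (List; []; _∷_; length; filter; allFin)
open import Data.List.Membership.Propositional using (_∈_)
open import Data.List.Membership.Propositional.Properties using (∈-filter⁺; ∈-filter⁻; ∈-allFin)
open import Data.List.Properties using (length-filter; length-tabulate)
open import Data.List.Relation.Binary.Pointwise using (Pointwise; Pointwise-≡⇒≡)
open import Data.List.Relation.Binary.Sublist.Heterogeneous.Properties using (length-mono-≤; toPointwise)
open import Data.List.Relation.Binary.Sublist.Propositional using (_⊆_; ⊆-refl)
open import Data.List.Relation.Binary.Sublist.Propositional.Properties using (filter⁺)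
open import Data.List.Relation.Unary.Any using (here; there)
open import Data.Nat
open import Data.Nat.Induction using (<-wellFounded)
open import Data.Nat.Properties
open import Data.Product using (_×_; _,_; proj₁; proj₂; ∃-syntax)
open import Data.Sum using (_⊎_; inj₁; inj₂; map₂)
open import Data.Unit using (tt)
open import Induction.WellFounded using (Acc; acc)
open import Relation.Binary.PropositionalEquality
open import Relation.Nullary using (¬_; Dec; yes; no; contradiction)
open import Relation.Nullary.Decidable using (_×-dec_; _⊎-dec_)
open import Relation.Unary using (Decidable)

open import Defs

-- Counting

∈⇒1≤length : ∀ {A : Set} {a : A} {xs : List A} → a ∈ xs → 1 ≤ length xs
∈⇒1≤length (here _)  = s≤s z≤n
∈⇒1≤length (there _) = s≤s z≤n

module _ {A : Set} {P Q : A → Set} (P? : Decidable P) (Q? : Decidable Q) where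

  length-filter-disjoint : (∀ a → P a → ¬ Q a) → ∀ xs →
                           length (filter P? xs) + length (filter Q? xs) ≤ length xs
  length-filter-disjoint disj [] = z≤n
  length-filter-disjoint disj (a ∷ xs) with ih ← length-filter-disjoint disj xs | P? a | Q? a
  ... | yes p | yes q = ⊥-elim (disj a p q)
  ... | yes _ | no _  = s≤s ih
  ... | no _  | yes _ = subst (_≤ suc (length xs)) (sym (+-suc _ _)) (s≤s ih)
  ... | no _  | no _  = m≤n⇒m≤1+n ih

  length-filter-⊎ : ∀ xs →
    length (filter (λ a → P? a ⊎-dec Q? a) xs) + length (filter (λ a → P? a ×-dec Q? a) xs)
      ≡ length (filter P? xs) + length (filter Q? xs)
  length-filter-⊎ [] = refl
  length-filter-⊎ (a ∷ xs) with ih ← length-filter-⊎ xs | P? a | Q? a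
  ... | yes _ | yes _ = cong suc (trans (+-suc _ _) (trans (cong suc ih) (sym (+-suc _ _))))
  ... | yes _ | no _  = cong suc ih
  ... | no _  | yes _ = trans (cong suc ih) (sym (+-suc _ _))
  ... | no _  | no _  = ih

  module _ (P⇒Q : ∀ {a} → P a → Q a) where

    filter-⊆ : ∀ xs → filter P? xs ⊆ filter Q? xs
    filter-⊆ xs = filter⁺ P? Q? {as = xs} (λ { refl → P⇒Q }) ⊆-refl

    length-filter-mono : ∀ xs → length (filter P? xs) ≤ length (filter Q? xs)
    length-filter-mono xs = length-mono-≤ (filter-⊆ xs)

    length-filter-≥⇒⊇ : ∀ xs → length (filter Q? xs) ≤ length (filter P? xs) →
                        ∀ {a} → a ∈ xs → Q a → P a
    length-filter-≥⇒⊇ xs Q≤P a∈xs qa =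
      proj₂ (∈-filter⁻ P? {xs = xs} (subst (_ ∈_) (sym (Pointwise-≡⇒≡ same)) (∈-filter⁺ Q? a∈xs qa)))
      where
      same : Pointwise _≡_ (filter P? xs) (filter Q? xs)
      same = toPointwise (≤-antisym (length-filter-mono xs) Q≤P) (filter-⊆ xs)

module _ {k : ℕ} where

  count≤k : ∀ {P : Fin k → Set} (P? : Decidable P) → count P? ≤ k
  count≤k P? = ≤-trans (length-filter P? (allFin k)) (≤-reflexive (length-tabulate (λ a → a)))

  count-pos : ∀ {P : Fin k → Set} (P? : Decidable P) {a} → P a → 1 ≤ count P?
  count-pos P? {a} pa = ∈⇒1≤length (∈-filter⁺ P? (∈-allFin a) pa)

module _ {k : ℕ} {P Q : Fin k → Set} (P? : Decidable P) (Q? : Decidable Q) where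

  count-disjoint : (∀ a → P a → ¬ Q a) → count P? + count Q? ≤ k
  count-disjoint disj = ≤-trans (length-filter-disjoint P? Q? disj (allFin k))
                                (≤-reflexive (length-tabulate (λ a → a)))

  count-⊎-< : ∀ {a} → P a → Q a → count (λ a → P? a ⊎-dec Q? a) < count P? + count Q?
  count-⊎-< pa qa =
    subst (count (λ a → P? a ⊎-dec Q? a) <_) (length-filter-⊎ P? Q? (allFin k))
          (m<m+n _ (count-pos (λ a → P? a ×-dec Q? a) (pa , qa)))

  module _ (P⇒Q : ∀ {a} → P a → Q a) where

    count-mono : count P? ≤ count Q?
    count-mono = length-filter-mono P? Q? P⇒Q (allFin k)

    count-≥⇒⊇ : count Q? ≤ count P? → ∀ a → Q a → P a
    count-≥⇒⊇ Q≤P a = length-filter-≥⇒⊇ P? Q? P⇒Q (allFin k) Q≤P (∈-allFin a)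

+-2*-suc : ∀ i t → i + 2 * suc t ≡ suc (suc (i + 2 * t))
+-2*-suc i t = begin
  i + 2 * suc t          ≡⟨ cong (i +_) (*-suc 2 t) ⟩
  i + suc (suc (2 * t))  ≡⟨ +-suc i (suc (2 * t)) ⟩
  suc (i + suc (2 * t))  ≡⟨ cong suc (+-suc i (2 * t)) ⟩
  suc (suc (i + 2 * t))  ∎
  where open ≡-Reasoning

even-or-odd : ∀ m → ∃[ t ] (m ≡ 2 * t ⊎ m ≡ suc (2 * t))
even-or-odd zero = 0 , inj₁ refl
even-or-odd (suc m) with even-or-odd m
... | t , inj₁ m≡2t   = t , inj₂ (cong suc m≡2t)
... | t , inj₂ m≡2t+1 = suc t , inj₁ (trans (cong suc m≡2t+1) (sym (*-suc 2 t)))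

k<2a⇒k<2b⇒k<a+b : ∀ {k a b} → k < 2 * a → k < 2 * b → k < a + b
k<2a⇒k<2b⇒k<a+b {k} {a} {b} k<2a k<2b = *-cancelˡ-≤ 2 (begin
  2 * suc k          ≡⟨ cong (suc k +_) (+-identityʳ (suc k)) ⟩
  suc k + suc k      ≤⟨ +-mono-≤ k<2a k<2b ⟩
  2 * a + 2 * b      ≡⟨ *-distribˡ-+ 2 a b ⟨
  2 * (a + b)        ∎)
  where open ≤-Reasoning

k≤1+s : ∀ {k} s → k ≡ 3 ⊎ k ≡ 4 → k < 2 * s → k ≤ suc s
k≤1+s (suc (suc s))       (inj₁ refl) _ = s≤s (s≤s (s≤s z≤n))
k≤1+s (suc zero)          (inj₁ refl) (s≤s (s≤s ()))
k≤1+s (suc (suc (suc s))) (inj₂ refl) _ = s≤s (s≤s (s≤s (s≤s z≤n)))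
k≤1+s (suc (suc zero))    (inj₂ refl) (s≤s (s≤s (s≤s (s≤s ()))))
k≤1+s (suc zero)          (inj₂ refl) (s≤s (s≤s ()))

module _ {n : ℕ} (adj : Fin n → Fin n → Bool) where
  open Graph adj

  _++ʷ_ : ∀ {u v w a b} → Walk u v a → Walk v w b → Walk u w (a + b)
  here     ++ʷ q = q
  step e p ++ʷ q = step e (p ++ʷ q)

  splitWalk : ∀ {u v m} j → j ≤ m → Walk u v m → ∃[ w ] (Walk u w j × Walk w v (m ∸ j))
  splitWalk zero    _         p          = _ , here , p
  splitWalk (suc j) (s≤s j≤m) (step e p) =
    let w , p₁ , p₂ = splitWalk j j≤m p in w , step e p₁ , p₂

-- Segments

-- Implicit arguments whose types mention Big, Alt, … are passed explicitly below:
-- otherwise Agda solves them by unfolding Big down to the clump counts, which is very slow.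
module AlternatingSegments {n k : ℕ} (adj : Fin n → Fin n → Bool) (col : Fin n → Fin k)
                           (lay : Fin n → ℕ) (D : ℕ) where
  open Layered adj col lay
  open Segments D

  Alt⇒SegType : ∀ {a s} → Alt a s → SegType a (a + 2 * s)
  Alt⇒SegType {s = zero}        (() , _)
  Alt⇒SegType {s = suc zero}    alt = inj₁ (refl , alt)
  Alt⇒SegType {s = suc (suc s)} alt = inj₂ (inj₁ (suc (suc s) , s≤s (s≤s z≤n) , refl , alt))

  Type1⊎Type2⇒Alt : ∀ {a b} → Type1 a b ⊎ Type2 a b → ∃[ s ] (b ≡ a + 2 * s × Alt a s)
  Type1⊎Type2⇒Alt (inj₁ (b≡a+2 , alt))          = 1 , b≡a+2 , alt
  Type1⊎Type2⇒Alt (inj₂ (s , _ , b≡a+2s , alt)) = s , b≡a+2s , alt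

  NearBig : ℕ → Set
  NearBig j = Big j ⊎ Big (suc j) ⊎ ∃[ p ] (j ≡ suc p × Big p)

  Alt⇒NearBig : ∀ {a s j} → Alt a s → a ≤ j → j ≤ a + 2 * s → NearBig j
  Alt⇒NearBig {a} {s} {j} (1≤s , _ , layers , _) a≤j j≤a+2s =
    subst NearBig (m+[n∸m]≡n a≤j) (near (even-or-odd (j ∸ a)) j∸a≤2s)
    where
    j∸a≤2s : j ∸ a ≤ 2 * s
    j∸a≤2s = subst (j ∸ a ≤_) (m+n∸m≡n a (2 * s)) (∸-monoˡ-≤ a j≤a+2s)

    big-at : ∀ t → t < s → Big (suc (a + 2 * t))
    big-at t t<s = subst (λ i → Big (i ∸ 1)) (+-2*-suc a t) (proj₁ (layers (suc t) (s≤s z≤n) t<s))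

    even : ∀ t → t < s ⊎ t ≡ s → NearBig (a + 2 * t)
    even t       (inj₁ t<s)  = inj₂ (inj₁ (big-at t t<s))
    even (suc u) (inj₂ refl) = inj₂ (inj₂ (suc (a + 2 * u) , +-2*-suc a u , big-at u ≤-refl))
    even zero    (inj₂ refl) = contradiction 1≤s λ ()

    near : ∀ {m} → ∃[ t ] (m ≡ 2 * t ⊎ m ≡ suc (2 * t)) → m ≤ 2 * s → NearBig (a + m)
    near (t , inj₁ refl) 2t≤2s   = even t (m≤n⇒m<n∨m≡n (*-cancelˡ-≤ 2 2t≤2s))
    near (t , inj₂ refl) 2t+1≤2s =
      inj₁ (subst Big (sym (+-suc a (2 * t))) (big-at t (*-cancelˡ-< 2 t s 2t+1≤2s)))

  AltStart : ℕ → Set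
  AltStart i = i ≡ 0 ⊎ Small (i ∸ 1)

  Bigs : ℕ → ℕ → Set
  Bigs i t = ∀ u → u ≤ t → Big (suc (i + 2 * u))

  -- Unlike Alt's end condition, the second case records e < D: Small (suc D) holds vacuously.
  AltEnd : ℕ → Set
  AltEnd e = e ≡ D ⊎ (e < D × Small (suc e))

  MaximalAlt : ℕ → Set
  MaximalAlt i = ∃[ t ] (Bigs i t × i + 2 * suc t ≤ D × AltEnd (i + 2 * suc t))

  Bigs-snoc : ∀ {i t} → Bigs i t → Big (suc (i + 2 * suc t)) → Bigs i (suc t)
  Bigs-snoc {i} {t} bigs big u u≤t+1 = case (m≤n⇒m<n∨m≡n u≤t+1)
    where
    case : u < suc t ⊎ u ≡ suc t → Big (suc (i + 2 * u))
    case (inj₁ (s≤s u≤t)) = bigs u u≤t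
    case (inj₂ refl)      = big

  Type3Start : ℕ → Set
  Type3Start i = i ≢ 0 → 2 < i × Big (i ∸ 2)

  SmallRun : ℕ → ℕ → Set
  SmallRun a b = ∀ j → a ≤ j → j ≤ b → Small j

  RunEnd : ℕ → Set
  RunEnd b = b ≡ D ⊎ (suc (suc b) < D × Big (suc (suc b)))

  MaximalRun : ℕ → Set
  MaximalRun a = ∃[ b ] (a ≤ b × b ≤ D × SmallRun a b × RunEnd b)

  SmallRun-snoc : ∀ {a b} → SmallRun a b → Small (suc b) → SmallRun a (suc b)
  SmallRun-snoc {b = b} run small j a≤j j≤b+1 = case (m≤n⇒m<n∨m≡n j≤b+1)
    where
    case : j < suc b ⊎ j ≡ suc b → Small j
    case (inj₁ (s≤s j≤b)) = run j a≤j j≤b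
    case (inj₂ refl)      = small

  mkType3 : ∀ {a b} → Type3Start a → a ≤ b → b ≤ D → SmallRun a b → RunEnd b → Type3 a b
  mkType3 {b = b} start a≤b b≤D run end = a≤b , b≤D , run , start , end′ end
    where
    end′ : RunEnd b → b ≢ D → b < D ∸ 2 × Big (b + 2)
    end′ (inj₁ b≡D)        b≢D = contradiction b≡D b≢D
    end′ (inj₂ (lt , big)) _   = ∸-monoˡ-≤ 2 lt , subst Big (+-comm 2 b) big

  big? : ∀ i → Dec (Big i)
  big? i = k <? 2 * sizeS i

  module _ (small-0 : Small 0) (small-D : Small D)
           (big-isolated : ∀ m → Big m → Small (suc m)) where

    small-unless-interior-big : ∀ {j} → j ≤ D → ¬ (j < D × Big j) → Small j
    small-unless-interior-big j≤D ¬interior big with m≤n⇒m<n∨m≡n j≤D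
    ... | inj₁ j<D  = ¬interior (j<D , big)
    ... | inj₂ refl = small-D big

    mkAlt : ∀ {i t} → AltStart i → Bigs i t → i + 2 * suc t ≤ D → AltEnd (i + 2 * suc t) →
            Alt i (suc t)
    mkAlt {i} {t} start bigs e≤D end = s≤s z≤n , e≤D , layers , start , map₂ proj₂ end
      where
      layers : ∀ j → 1 ≤ j → j ≤ suc t →
               Big (i + 2 * j ∸ 1) × Small (i + 2 * (j ∸ 1)) × Small (i + 2 * j)
      layers (suc u) _ (s≤s u≤t) =
        subst (λ z → Big (z ∸ 1)) (sym (+-2*-suc i u)) big ,
        (λ big′ → big-isolated _ big′ big) ,
        subst Small (sym (+-2*-suc i u)) (big-isolated _ big)
        where
        big : Big (suc (i + 2 * u))
        big = bigs u u≤t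

    maximal-alt : ∀ {i} → Big (suc i) → suc i < D → MaximalAlt i
    maximal-alt {i} big i+1<D = extend 0 (D ∸ (i + 2)) first (m+[n∸m]≡n i+2≤D)
      where
      first : Bigs i 0
      first zero _ = subst (λ z → Big (suc z)) (sym (+-identityʳ i)) big

      i+2≤D : i + 2 ≤ D
      i+2≤D = subst (_≤ D) (+-comm 2 i) i+1<D

      extend : ∀ t r → Bigs i t → i + 2 * suc t + r ≡ D → MaximalAlt i
      extend t zero bigs e+0≡D =
        t , bigs , subst (_ ≤_) e+0≡D (m≤m+n _ 0) , inj₁ (trans (sym (+-identityʳ _)) e+0≡D)
      extend t (suc r) bigs e+r≡D = continue r e+r≡D (big? (suc e))
        where
        e : ℕ
        e = i + 2 * suc t

        continue : ∀ r → e + suc r ≡ D → Dec (Big (suc e)) → MaximalAlt i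
        continue r e+r≡D (no small) =
          t , bigs , subst (e ≤_) e+r≡D (m≤m+n e (suc r)) ,
          inj₂ (subst (e <_) e+r≡D (m<m+n e (s≤s z≤n)) , small)
        continue zero e+1≡D (yes big′) =
          contradiction (subst Big (trans (+-comm 1 e) e+1≡D) big′) small-D
        continue (suc r) e+r≡D (yes big′) = extend (suc t) r (Bigs-snoc {i} {t} bigs big′) (begin
          i + 2 * suc (suc t) + r  ≡⟨ cong (_+ r) (+-2*-suc i (suc t)) ⟩
          suc (suc (e + r))        ≡⟨ cong suc (+-suc e r) ⟨
          suc (e + suc r)          ≡⟨ +-suc e (suc r) ⟨
          e + suc (suc r)          ≡⟨ e+r≡D ⟩
          D                        ∎)
          where open ≡-Reasoning

    maximal-small-run : ∀ {a} → a ≤ D → Small a → (suc a ≤ D → Small (suc a)) → MaximalRun a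
    maximal-small-run {a} a≤D small next =
      extend a (D ∸ a) ≤-refl (m+[n∸m]≡n a≤D) (λ j a≤j j≤a → subst Small (≤-antisym a≤j j≤a) small) next
      where
      extend : ∀ b r → a ≤ b → b + r ≡ D → SmallRun a b → (suc b ≤ D → Small (suc b)) →
               MaximalRun a
      extend b zero a≤b b+0≡D run _ =
        b , a≤b , subst (b ≤_) b+0≡D (m≤m+n b 0) , run , inj₁ (trans (sym (+-identityʳ b)) b+0≡D)
      extend b (suc r) a≤b b+r≡D run next = continue (suc (suc b) <? D ×-dec big? (suc (suc b)))
        where
        b+1≤D : suc b ≤ D
        b+1≤D = subst (suc b ≤_) (trans (sym (+-suc b r)) b+r≡D) (m≤m+n (suc b) r)

        continue : Dec (suc (suc b) < D × Big (suc (suc b))) → MaximalRun a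
        continue (yes stop) = b , a≤b , <⇒≤ b+1≤D , run , inj₂ stop
        continue (no ¬stop) =
          extend (suc b) r (m≤n⇒m≤1+n a≤b) (trans (sym (+-suc b r)) b+r≡D)
                 (SmallRun-snoc {a} {b} run (next b+1≤D)) (λ le → small-unless-interior-big le ¬stop)

    Type3Start⇒AltStart : ∀ {f} → Type3Start f → AltStart f
    Type3Start⇒AltStart {zero}        _     = inj₁ refl
    Type3Start⇒AltStart {suc zero}    start with s≤s () ← proj₁ (start (λ ()))
    Type3Start⇒AltStart {suc (suc f)} start = inj₂ (big-isolated f (proj₂ (start (λ ()))))

    -- The scan from a small layer f: if L_{f+1} is big, an alternating segment starts at f;
    -- otherwise a Type 3 segment runs until two layers before the next big one.  The recursive
    -- call is abstracted as a Continuation, so only partition-from needs a termination measure.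
    Continuation : ℕ → Set
    Continuation f = ∀ g → f < g → g ≤ D → Small g → Type3Start g → Partition SegType g D

    partition-from-alt : ∀ g → suc g < D → Big (suc g) → AltStart g → Continuation g →
                         Partition SegType g D
    partition-from-alt g g+1<D big start continue = from-maximal (maximal-alt {g} big g+1<D)
      where
      from-maximal : MaximalAlt g → Partition SegType g D
      from-maximal (t , bigs , e≤D , inj₁ e≡D) =
        subst (Partition SegType g) e≡D
              (one (Alt⇒SegType {g} {suc t} (mkAlt {g} {t} start bigs e≤D (inj₁ e≡D))))
      from-maximal (t , bigs , e≤D , inj₂ (e<D , small)) =
        cons (Alt⇒SegType {g} {suc t} (mkAlt {g} {t} start bigs e≤D (inj₂ (e<D , small))))
             (continue _ (s≤s (m≤m+n g (2 * suc t))) e<D small after)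
        where
        after : Type3Start (suc (g + 2 * suc t))
        after _ = subst (λ e → 2 < suc e × Big (e ∸ 1)) (sym (+-2*-suc g t))
                        (s≤s (s≤s (s≤s z≤n)) , bigs t ≤-refl)

    partition-step : ∀ f → f ≤ D → Small f → Type3Start f → Continuation f →
                     Partition SegType f D
    partition-step f f≤D small start continue = by-cases (suc f <? D ×-dec big? (suc f))
      where
      after-run : MaximalRun f → Partition SegType f D
      after-run (b , f≤b , b≤D , run , inj₁ b≡D) =
        subst (Partition SegType f) b≡D
              (one (inj₂ (inj₂ (mkType3 {f} {b} start f≤b b≤D run (inj₁ b≡D)))))
      after-run (b , f≤b , b≤D , run , inj₂ (b+2<D , big)) =
        cons (inj₂ (inj₂ (mkType3 {f} {b} start f≤b b≤D run (inj₂ (b+2<D , big)))))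
             (partition-from-alt (suc b) b+2<D big (inj₂ (run b f≤b ≤-refl))
               (λ g b+1<g → continue g (≤-<-trans f≤b (<-trans (n<1+n b) b+1<g))))

      by-cases : Dec (suc f < D × Big (suc f)) → Partition SegType f D
      by-cases (yes (f+1<D , big)) =
        partition-from-alt f f+1<D big (Type3Start⇒AltStart {f} start) continue
      by-cases (no ¬interior) =
        after-run (maximal-small-run {f} f≤D small (λ le → small-unless-interior-big le ¬interior))

    partition-from : ∀ f → Acc _<_ (D ∸ f) → f ≤ D → Small f → Type3Start f →
                     Partition SegType f D
    partition-from f (acc rec) f≤D small start = partition-step f f≤D small start
      (λ g f<g g≤D → partition-from g (rec (∸-monoʳ-< f<g g≤D)) g≤D)

    partition : Partition SegType 0 D
    partition = partition-from 0 (<-wellFounded D) z≤n small-0 (λ 0≢0 → contradiction refl 0≢0)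

-- Strongly canonical clump graphs

module CanonicalLayering
  {k n : ℕ} {adj : Fin n → Fin n → Bool} {col : Fin n → Fin k}
  {x : Fin n} {lay : Fin n → ℕ} {D : ℕ}
  (k≥3 : 3 ≤ k) (SC : StronglyCanonical k n adj col x lay D) where

  open Layered adj col lay
  open StronglyCanonical SC
  open AlternatingSegments adj col lay D using (NearBig; Alt⇒NearBig; Type1⊎Type2⇒Alt)

  lay≤D : ∀ v → lay v ≤ D
  lay≤D v = diamBound x v (lay v) (layDist v)

  layer-nonempty : ∀ {j} → j ≤ D → ∃[ w ] lay w ≡ j
  layer-nonempty {j} j≤D =
    let v , lv≡D = eccAttained
        j≤lv = subst (j ≤_) (sym lv≡D) j≤D
        w , x→w , w→v = splitWalk adj j j≤lv (proj₁ (layDist v))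
        lv≤lw+rest : lay v ≤ lay w + (lay v ∸ j)
        lv≤lw+rest = proj₂ (layDist v) _ (_++ʷ_ adj (proj₁ (layDist w)) w→v)
        j≤lw : j ≤ lay w
        j≤lw = +-cancelʳ-≤ (lay v ∸ j) j (lay w)
                 (subst (_≤ lay w + (lay v ∸ j)) (sym (m+[n∸m]≡n j≤lv)) lv≤lw+rest)
    in w , ≤-antisym (proj₂ (layDist w) j x→w) j≤lw

  c-pos : ∀ {j} → j ≤ D → 1 ≤ c j
  c-pos j≤D = let w , lw = layer-nonempty j≤D in count-pos (isClump? _) (w , lw , refl)

  clump⇒≤D : ∀ {i a} → IsClump i a → i ≤ D
  clump⇒≤D (v , refl , _) = lay≤D v

  same-colour-¬ClumpAdj : ∀ {i j a} → ¬ ClumpAdj i a j a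
  same-colour-¬ClumpAdj (u , v , e , _ , cu , _ , cv) = proper u v e (trans cu (sym cv))

  saturated-ClumpAdj : ∀ {i j a b} → a ≢ b → IsClump i a → IsClump j b →
                       i ≡ j ⊎ suc i ≡ j ⊎ i ≡ suc j → ClumpAdj i a j b
  saturated-ClumpAdj a≢b (u , refl , refl) (v , refl , refl) near =
    u , v , saturated u v a≢b near , refl , refl , refl , refl

  sizeS≤c : ∀ j → sizeS j ≤ c j
  sizeS≤c j = count-mono (inS? j) (isClump? j) proj₁

  c-next+sizeS≤k : ∀ j → c (suc j) + sizeS j ≤ k
  c-next+sizeS≤k j = count-disjoint (isClump? (suc j)) (inS? j)
    (λ a clump inS → same-colour-¬ClumpAdj (proj₂ (proj₂ inS) a clump))

  c-prev+sizeS≤k : ∀ p → c p + sizeS (suc p) ≤ k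
  c-prev+sizeS≤k p = count-disjoint (isClump? p) (inS? (suc p))
    (λ a clump inS → same-colour-¬ClumpAdj (proj₁ (proj₂ inS) a clump))

  big-isolated : ∀ m → Big m → Small (suc m)
  big-isolated m big big′ = <⇒≱ (k<2a⇒k<2b⇒k<a+b {a = sizeS (suc m)} {b = sizeS m} big′ big)
    (≤-trans (+-monoˡ-≤ (sizeS m) (sizeS≤c (suc m))) (c-next+sizeS≤k m))

  c≡1⇒Small : ∀ {i} → c i ≡ 1 → Small i
  c≡1⇒Small {i} c≡1 big =
    <⇒≱ (≤-trans big (*-monoʳ-≤ 2 (subst (sizeS i ≤_) c≡1 (sizeS≤c i)))) (≤-trans (n≤1+n 2) k≥3)

  small-0 : Small 0
  small-0 = c≡1⇒Small c0

  small-D : Small D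
  small-D = c≡1⇒Small cD

  shared-colour⇒k<c+c : ∀ {i a} → i < D → IsClump i a → IsClump (suc i) a →
                        k < c i + c (suc i)
  shared-colour⇒k<c+c {i} i<D p q with k <? c i + c (suc i)
  ... | yes k<c+c = k<c+c
  ... | no  k≮c+c = contradiction
    (subst (_< c i + c (suc i)) union≡c+c (count-⊎-< (isClump? i) (isClump? (suc i)) p q))
    (<-irrefl refl)
    where
    union≡c+c : cUnion i ≡ c i + c (suc i)
    union≡c+c = trans (canonB i i<D) (m≥n⇒m⊓n≡n (≮⇒≥ k≮c+c))

  c≡1⇒no-shared-colour-above : ∀ {j a} → j < D → c j ≡ 1 → IsClump j a → ¬ IsClump (suc j) a
  c≡1⇒no-shared-colour-above {j} j<D c≡1 p q =
    <⇒≱ (subst (λ cj → k < cj + c (suc j)) c≡1 (shared-colour⇒k<c+c j<D p q)) 1+c≤k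
    where
    1+c≤k : 1 + c (suc j) ≤ k
    1+c≤k = subst (_≤ k) (+-comm (c (suc j)) 1)
      (subst (c (suc j) + 1 ≤_) (m∸n+n≡m (≤-trans (s≤s z≤n) k≥3)) (+-monoˡ-≤ 1 (canonA j j<D c≡1)))

  c≤1⇒no-shared-colour-below : ∀ {p a} → suc p ≤ D → c (suc p) ≤ 1 → IsClump p a →
                               ¬ IsClump (suc p) a
  c≤1⇒no-shared-colour-below {p} p<D c≤1 q r = ≤⇒≯ c≤1 (proj₂ (canonC p p<D c≡k))
    where
    k≤c : k ≤ c p
    k≤c = +-cancelʳ-≤ 1 k (c p)
      (≤-trans (subst (_≤ c p + c (suc p)) (+-comm 1 k) (shared-colour⇒k<c+c p<D q r))
               (+-monoʳ-≤ (c p) c≤1))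
    c≡k : c p ≡ k
    c≡k = ≤-antisym (count≤k (isClump? p)) k≤c

  c≤1⇒⊆S : ∀ {j} → c j ≤ 1 → ∀ e → IsClump j e → InS j e
  c≤1⇒⊆S {j} c≤1 e clump = clump , prev j c≤1 clump , next
    where
    prev : ∀ j → c j ≤ 1 → IsClump j e → PrevOK j e
    prev zero    _   _     = tt
    prev (suc p) c≤1 clump b clump′ = saturated-ClumpAdj e≢b clump clump′ (inj₂ (inj₂ refl))
      where
      e≢b : e ≢ b
      e≢b refl = c≤1⇒no-shared-colour-below (clump⇒≤D clump) c≤1 clump′ clump
    next : NextOK j e
    next b clump′ = saturated-ClumpAdj e≢b clump clump′ (inj₂ (inj₁ refl))
      where
      e≢b : e ≢ b
      e≢b refl = c≡1⇒no-shared-colour-above (clump⇒≤D clump′)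
        (≤-antisym c≤1 (count-pos (isClump? j) clump)) clump clump′

  module SmallPalette (k∈3,4 : k ≡ 3 ⊎ k ≡ 4) where

    Big⇒k≤1+sizeS : ∀ {j} → Big j → k ≤ suc (sizeS j)
    Big⇒k≤1+sizeS {j} = k≤1+s (sizeS j) k∈3,4

    Big⇒c-next≤1 : ∀ {j} → Big j → c (suc j) ≤ 1
    Big⇒c-next≤1 {j} big = +-cancelʳ-≤ (sizeS j) (c (suc j)) 1
      (≤-trans (c-next+sizeS≤k j) (Big⇒k≤1+sizeS big))

    Big⇒c-prev≤1 : ∀ {p} → Big (suc p) → c p ≤ 1
    Big⇒c-prev≤1 {p} big = +-cancelʳ-≤ (sizeS (suc p)) (c p) 1
      (≤-trans (c-prev+sizeS≤k p) (Big⇒k≤1+sizeS big))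

    Big⇒k∸1≤sizeS : ∀ {j} → Big j → k ∸ 1 ≤ sizeS j
    Big⇒k∸1≤sizeS big = ∸-monoˡ-≤ 1 (Big⇒k≤1+sizeS big)

    Big⇒c≤k∸1 : ∀ {j} → j < D → Big j → c j ≤ k ∸ 1
    Big⇒c≤k∸1 {j} j<D big = ∸-monoˡ-≤ 1 (≤∧≢⇒< (count≤k (isClump? j))
      (λ c≡k → ≤⇒≯ (Big⇒c-next≤1 big) (proj₂ (canonC j j<D c≡k))))

    Big⇒c≡k∸1 : ∀ {j} → j < D → Big j → c j ≡ k ∸ 1
    Big⇒c≡k∸1 {j} j<D big =
      ≤-antisym (Big⇒c≤k∸1 j<D big) (≤-trans (Big⇒k∸1≤sizeS big) (sizeS≤c j))

    Big⇒⊆S : ∀ {j} → j < D → Big j → ∀ e → IsClump j e → InS j e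
    Big⇒⊆S {j} j<D big = count-≥⇒⊇ (inS? j) (isClump? j) proj₁
      (≤-trans (Big⇒c≤k∸1 j<D big) (Big⇒k∸1≤sizeS big))

    NearBig⇒⊆S×c∈1,k∸1 : ∀ {j} → j ≤ D → NearBig j →
      (∀ e → IsClump j e → InS j e) × (c j ≡ 1 ⊎ c j ≡ k ∸ 1)
    NearBig⇒⊆S×c∈1,k∸1 {j} j≤D (inj₁ big) = Big⇒⊆S j<D big , inj₂ (Big⇒c≡k∸1 j<D big)
      where
      j<D : j < D
      j<D = ≤∧≢⇒< j≤D (λ { refl → small-D big })
    NearBig⇒⊆S×c∈1,k∸1 {j} j≤D (inj₂ (inj₁ big)) =
      c≤1⇒⊆S c≤1 , inj₁ (≤-antisym c≤1 (c-pos j≤D))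
      where
      c≤1 : c j ≤ 1
      c≤1 = Big⇒c-prev≤1 big
    NearBig⇒⊆S×c∈1,k∸1 {j} j≤D (inj₂ (inj₂ (p , refl , big))) =
      c≤1⇒⊆S c≤1 , inj₁ (≤-antisym c≤1 (c-pos j≤D))
      where
      c≤1 : c j ≤ 1
      c≤1 = Big⇒c-next≤1 big

    alternating-layer : ∀ {a b j} → Segments.Type1 D a b ⊎ Segments.Type2 D a b →
                        a ≤ j → j ≤ b →
                        (∀ e → IsClump j e → InS j e) × (c j ≡ 1 ⊎ c j ≡ k ∸ 1)
    alternating-layer {a} {b} {j} segment a≤j j≤b =
      let s , b≡a+2s , alt = Type1⊎Type2⇒Alt segment
          j≤a+2s = subst (j ≤_) b≡a+2s j≤b
      in NearBig⇒⊆S×c∈1,k∸1 (≤-trans j≤a+2s (proj₁ (proj₂ alt)))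
                            (Alt⇒NearBig {a} {s} {j} alt a≤j j≤a+2s)

lemma4p6 : (k : ℕ) → 3 ≤ k →
    (n : ℕ) (adj : Fin n → Fin n → Bool) (col : Fin n → Fin k)
    (x : Fin n) (lay : Fin n → ℕ) (D : ℕ) →
    StronglyCanonical k n adj col x lay D →
    Layered.Partition adj col lay (Layered.Segments.SegType adj col lay D) 0 D
    × ((k ≡ 3 ⊎ k ≡ 4) →
       ∀ a b j →
       (Layered.Segments.Type1 adj col lay D a b ⊎ Layered.Segments.Type2 adj col lay D a b) →
       a ≤ j → j ≤ b →
       (∀ e → Layered.IsClump adj col lay j e → Layered.InS adj col lay j e)
       × (Layered.c adj col lay j ≡ 1 ⊎ Layered.c adj col lay j ≡ k ∸ 1))
lemma4p6 k k≥3 n adj col x lay D SC =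
  partition small-0 small-D big-isolated ,
  λ k∈3,4 a b j → SmallPalette.alternating-layer k∈3,4 {a} {b} {j}
  where
  open CanonicalLayering k≥3 SC
  open AlternatingSegments adj col lay D using (partition)
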